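{- There exists an octahedral system $\Omega=(V_1,\ldots,V_n,E)$ with $n=|V_1|=\cdots=|V_n|=d+1$ (for some $d\ge1$) which is not realisable.
   Context: An $n$-uniform hypergraph is $n$-partite if its vertex set is the disjoint union of $n$ sets $V_1,\ldots,V_n$ and each edge meets each $V_i$ in exactly one vertex; it is written $(V_1,\ldots,V_n,E)$. An octahedral system is such a hypergraph with $|V_i|\ge 2$ for all $i$ satisfying the parity condition: for every $X\subseteq\bigcup_i V_i$ with $|X\cap V_i|=2$ for all $i$, the number of edges contained in $X$ is even. A colourful point configuration in $\mathbb{R}^d$ is a collection of $d+1$ finite sets $\mathbf{S}_1,\ldots,\mathbf{S}_{d+1}\subset\mathbb{R}^d$; a colourful simplex is the convex hull of a set containing exactly one point of each $\mathbf{S}_i$. An octahedral system with $n=|V_i|=d+1$ is realisable if it arises from some colourful point configuration in $\mathbb{R}^d$, i.e. there are bijections $V_i\to\mathbf{S}_i$ under which the edges correspond exactly to the colourful simplices containing the origin. -}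

module Defs where

open import Level using (Level; suc; _⊔_)
open import Data.Nat as ℕ using (ℕ; _≥_)
open import Data.Nat.Divisibility using (_∣_)
open import Data.Fin using (Fin)
open import Data.Bool using (Bool; true; false; if_then_else_)
open import Data.Product using (Σ; ∃; _×_; _,_)
open import Data.Sum using (_⊎_)
open import Data.Vec.Functional using (_∷_)
open import Relation.Nullary using (¬_)
open import Relation.Binary.PropositionalEquality using (_≡_)
open import Relation.Binary.Structures using (IsStrictTotalOrder)
open import Algebra.Structures using (IsCommutativeRing)
open import Function.Bundles using (_⇔_)

record OrderedField (c : Level) : Set (suc c) where
  infixl 7 _*_
  infixl 6 _+_
  infix  4 _<_ _≤_
  field
    Carrier  : Set c
    _+_ _*_  : Carrier → Carrier → Carrier
    -_       : Carrier → Carrier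
    0# 1#    : Carrier
    _<_      : Carrier → Carrier → Set c
    isCommutativeRing : IsCommutativeRing _≡_ _+_ _*_ -_ 0# 1#
    0≢1      : ¬ (0# ≡ 1#)
    inverse  : ∀ x → ¬ (x ≡ 0#) → ∃ λ y → x * y ≡ 1#
    isStrictTotalOrder : IsStrictTotalOrder _≡_ _<_
    +-mono-< : ∀ {x y} z → x < y → x + z < y + z
    *-pos    : ∀ {x y} → 0# < x → 0# < y → 0# < x * y

  _≤_ : Carrier → Carrier → Set c
  x ≤ y = x < y ⊎ x ≡ y

  sumF : ∀ {n} → (Fin n → Carrier) → Carrier
  sumF {ℕ.zero}  f = 0#
  sumF {ℕ.suc n} f = f Fin.zero + sumF (λ i → f (Fin.suc i))

-- n-partite n-uniform hypergraphs with parts V_i = Fin m (i : Fin n).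
-- An edge is a transversal  Fin n → Fin m  (one vertex in each part);
-- the edge set is given by its (decidable) indicator.

Hypergraph : ℕ → ℕ → Set
Hypergraph n m = (Fin n → Fin m) → Bool

countBool : ∀ n → ((Fin n → Bool) → Bool) → ℕ
countBool ℕ.zero    P = if P (λ ()) then 1 else 0
countBool (ℕ.suc n) P = countBool n (λ s → P (true ∷ s))
                      ℕ.+ countBool n (λ s → P (false ∷ s))

-- X with X ∩ V_i = {a i , b i} (a i ≠ b i); edges contained in X are the
-- transversals choosing a i or b i in every part.
edgesIn : ∀ {n m} → Hypergraph n m → (a b : Fin n → Fin m) → ℕ
edgesIn {n} E a b = countBool n (λ s → E (λ i → if s i then a i else b i))

IsOctahedral : ∀ {n m} → Hypergraph n m → Set
IsOctahedral {n} {m} E =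
  m ≥ 2 ×
  ((a b : Fin n → Fin m) → (∀ i → ¬ (a i ≡ b i)) → 2 ∣ edgesIn E a b)

module _ {c : Level} (F : OrderedField c) where
  open OrderedField F

  Point : ℕ → Set c
  Point d = Fin d → Carrier

  OriginInHull : ∀ {n d} → (Fin n → Point d) → Set c
  OriginInHull {n} {d} q =
    ∃ λ (t : Fin n → Carrier) →
      (∀ i → 0# ≤ t i) × sumF t ≡ 1# × (∀ k → sumF (λ i → t i * q i k) ≡ 0#)

  -- S i = { P i v | v : Fin (d+1) } ⊂ F^d, with v ↦ P i v a bijection
  -- V_i → S_i, and edges ↔ colourful simplices containing the origin.
  RealisableOver : ∀ d → Hypergraph (ℕ.suc d) (ℕ.suc d) → Set c
  RealisableOver d E =
    ∃ λ (P : Fin (ℕ.suc d) → Fin (ℕ.suc d) → Point d) →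
      (∀ i u v → (∀ k → P i u k ≡ P i v k) → u ≡ v) ×
      (∀ (f : Fin (ℕ.suc d) → Fin (ℕ.suc d)) →
         (E f ≡ true) ⇔ OriginInHull (λ i → P i (f i)))

module Submission where

-- The example: three colour classes of size 3 (d = 2) and edges
-- E = { (v₁ , v₂ , v₃) : v₂ = v₃ }.  E ignores colour 1, so inside any X its
-- edges pair up and E is octahedral (cylinder-octahedral).  In a planar
-- realisation fix x ∈ S₁; then 0 ∈ conv(x , yᵢ , zⱼ) iff i = j.  If x = 0
-- every triangle contains 0.  Otherwise, measured by ⟨x , ·⟩ and det(x , ·),
-- containment means a nonzero nonnegative combination of y and z lies on the
-- ray opposite to x (hull⇔cone).  No yᵢ, zᵢ lies on that ray, so each diagonal
-- pair straddles the line through x (straddle), two pairs straddle alike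
-- (pigeonhole), and for them containment is the sign of a bilinear form
-- (cone⇔crossing), which by the exchange inequality makes a crossed triangle
-- contain 0 too (crossed-pair).

open import Defs
open import Level using (0ℓ)
open import Data.Nat as ℕ using (ℕ; suc; zero; _≥_; s≤s; z≤n)
import Data.Nat.Properties as ℕ
open import Data.Nat.Divisibility using (_∣_; divides)
open import Data.Integer as ℤ using (ℤ; -[1+_]) renaming (+_ to pos)
import Data.Integer.Properties as ℤ
open import Data.Sign as Sign using (Sign)
open import Data.Maybe using (Maybe; just; nothing)
open import Data.Fin as Fin using (Fin; zero; suc)
open import Data.Fin.Properties using (pigeonhole; <⇒≢)
open import Data.Bool using (true)
open import Data.Product using (∃; ∃₂; _×_; _,_)
open import Data.Sum using (_⊎_; inj₁; inj₂; [_,_]) renaming (map to ⊎-map)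
open import Data.Empty using (⊥; ⊥-elim)
open import Data.Vec.Functional using (_∷_; [])
open import Function using (_∘_)
open import Function.Bundles using (_⇔_; mk⇔; Equivalence)
open import Function.Construct.Composition using (_⇔-∘_)
open import Function.Construct.Symmetry using (⇔-sym)
open import Relation.Nullary using (¬_; yes; no)
open import Relation.Nullary.Decidable using (⌊_⌋)
import Relation.Binary.PropositionalEquality as ≡
open ≡ using (_≡_; _≢_)
open import Relation.Binary.Structures using (IsStrictTotalOrder)
open import Relation.Binary.Definitions using (tri<; tri≈; tri>)
open import Algebra.Bundles using (CommutativeRing)
open import Algebra.Solver.Ring.AlmostCommutativeRing
  using (fromCommutativeRing; _-Raw-AlmostCommutative⟶_)
import Algebra.Solver.Ring as RingSolver

-- Every commutative ring receives the canonical ring morphism from ℤ;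
-- it lets the stdlib ring solver normalise polynomial identities with
-- integer coefficients in that ring.
module IntegerCoefficients {c ℓ} (R : CommutativeRing c ℓ) where
  open CommutativeRing R
  open import Algebra.Properties.Ring ring using (-1*x≈-x; -‿distribʳ-*)
  open import Algebra.Properties.Group +-group using (ε⁻¹≈ε; ⁻¹-involutive; ⁻¹-anti-homo-∙)
  open import Algebra.Properties.Semiring.Mult semiring using (×-homo-+; ×1-homo-*) renaming (_×_ to _×ᴿ_)
  open import Relation.Binary.Reasoning.Setoid setoid

  ι : ℕ → Carrier
  ι n = n ×ᴿ 1#

  ⟦_⟧ℤ : ℤ → Carrier
  ⟦ pos n ⟧ℤ = ι n
  ⟦ -[1+ n ] ⟧ℤ = - ι (suc n)

  cancel-one : ∀ u v → (1# + u) + - (1# + v) ≈ u + - v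
  cancel-one u v = begin
    (1# + u) + - (1# + v)   ≈⟨ +-congˡ (⁻¹-anti-homo-∙ 1# v) ⟩
    (1# + u) + (- v + - 1#) ≈⟨ +-congˡ (+-comm (- v) (- 1#)) ⟩
    (1# + u) + (- 1# + - v) ≈⟨ +-assoc 1# u (- 1# + - v) ⟩
    1# + (u + (- 1# + - v)) ≈⟨ +-congˡ (sym (+-assoc u (- 1#) (- v))) ⟩
    1# + ((u + - 1#) + - v) ≈⟨ +-congˡ (+-congʳ (+-comm u (- 1#))) ⟩
    1# + ((- 1# + u) + - v) ≈⟨ +-congˡ (+-assoc (- 1#) u (- v)) ⟩
    1# + (- 1# + (u + - v)) ≈⟨ sym (+-assoc 1# (- 1#) (u + - v)) ⟩
    (1# + - 1#) + (u + - v) ≈⟨ +-congʳ (-‿inverseʳ 1#) ⟩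
    0# + (u + - v)          ≈⟨ +-identityˡ (u + - v) ⟩
    u + - v                 ∎

  ⊖-homo : ∀ m n → ⟦ m ℤ.⊖ n ⟧ℤ ≈ ι m + - ι n
  ⊖-homo 0 0 = sym (trans (+-congˡ ε⁻¹≈ε) (+-identityʳ 0#))
  ⊖-homo 0 (suc n) = sym (+-identityˡ _)
  ⊖-homo (suc m) 0 = sym (trans (+-congˡ ε⁻¹≈ε) (+-identityʳ _))
  ⊖-homo (suc m) (suc n) = begin
    ⟦ suc m ℤ.⊖ suc n ⟧ℤ ≡⟨ ≡.cong ⟦_⟧ℤ (ℤ.[1+m]⊖[1+n]≡m⊖n m n) ⟩
    ⟦ m ℤ.⊖ n ⟧ℤ          ≈⟨ ⊖-homo m n ⟩
    ι m + - ι n          ≈⟨ cancel-one (ι m) (ι n) ⟨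
    ι (suc m) + - ι (suc n) ∎

  +-homo : ∀ i j → ⟦ i ℤ.+ j ⟧ℤ ≈ ⟦ i ⟧ℤ + ⟦ j ⟧ℤ
  +-homo (pos m) (pos n) = ×-homo-+ 1# m n
  +-homo (pos m) -[1+ n ] = ⊖-homo m (suc n)
  +-homo -[1+ m ] (pos n) = trans (⊖-homo n (suc m)) (+-comm _ _)
  +-homo -[1+ m ] -[1+ n ] = begin
    - ι (suc (suc (m ℕ.+ n)))    ≈⟨ -‿cong (+-congˡ (×-homo-+ 1# (suc m) n)) ⟩
    - (1# + (ι (suc m) + ι n))   ≈⟨ -‿cong (sym (+-assoc 1# (ι (suc m)) (ι n))) ⟩
    - ((1# + ι (suc m)) + ι n)   ≈⟨ -‿cong (+-congʳ (+-comm 1# (ι (suc m)))) ⟩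
    - ((ι (suc m) + 1#) + ι n)   ≈⟨ -‿cong (+-assoc (ι (suc m)) 1# (ι n)) ⟩
    - (ι (suc m) + ι (suc n))    ≈⟨ ⁻¹-anti-homo-∙ (ι (suc m)) (ι (suc n)) ⟩
    - ι (suc n) + - ι (suc m)    ≈⟨ +-comm _ _ ⟩
    - ι (suc m) + - ι (suc n)    ∎

  ⟦_⟧± : Sign → Carrier
  ⟦ Sign.+ ⟧± = 1#
  ⟦ Sign.- ⟧± = - 1#

  sign-homo : ∀ s t → ⟦ s Sign.* t ⟧± ≈ ⟦ s ⟧± * ⟦ t ⟧±
  sign-homo Sign.+ t = sym (*-identityˡ _)
  sign-homo Sign.- Sign.+ = sym (*-identityʳ _)
  sign-homo Sign.- Sign.- = begin
    1#          ≈⟨ ⁻¹-involutive 1# ⟨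
    - - 1#      ≈⟨ -‿cong (-1*x≈-x 1#) ⟨
    - (- 1# * 1#) ≈⟨ -‿distribʳ-* (- 1#) 1# ⟩
    - 1# * - 1# ∎

  ◃-homo : ∀ s n → ⟦ s ℤ.◃ n ⟧ℤ ≈ ⟦ s ⟧± * ι n
  ◃-homo s 0 = sym (zeroʳ _)
  ◃-homo Sign.+ (suc n) = sym (*-identityˡ _)
  ◃-homo Sign.- (suc n) = sym (-1*x≈-x _)

  sign-abs : ∀ i → ⟦ i ⟧ℤ ≈ ⟦ ℤ.sign i ⟧± * ι ℤ.∣ i ∣
  sign-abs (pos n) = sym (*-identityˡ _)
  sign-abs -[1+ n ] = sym (-1*x≈-x _)

  -- multiplication splits into signs and absolute values
  *-homo : ∀ i j → ⟦ i ℤ.* j ⟧ℤ ≈ ⟦ i ⟧ℤ * ⟦ j ⟧ℤ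
  *-homo i j = begin
    ⟦ (sᵢ Sign.* sⱼ) ℤ.◃ (mᵢ ℕ.* mⱼ) ⟧ℤ  ≈⟨ ◃-homo (sᵢ Sign.* sⱼ) (mᵢ ℕ.* mⱼ) ⟩
    ⟦ sᵢ Sign.* sⱼ ⟧± * ι (mᵢ ℕ.* mⱼ)    ≈⟨ *-cong (sign-homo sᵢ sⱼ) (×1-homo-* mᵢ mⱼ) ⟩
    (⟦ sᵢ ⟧± * ⟦ sⱼ ⟧±) * (ι mᵢ * ι mⱼ)  ≈⟨ interchange ⟦ sᵢ ⟧± ⟦ sⱼ ⟧± (ι mᵢ) (ι mⱼ) ⟩
    (⟦ sᵢ ⟧± * ι mᵢ) * (⟦ sⱼ ⟧± * ι mⱼ)  ≈⟨ *-cong (sign-abs i) (sign-abs j) ⟨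
    ⟦ i ⟧ℤ * ⟦ j ⟧ℤ ∎
    where
    sᵢ sⱼ : Sign
    sᵢ = ℤ.sign i
    sⱼ = ℤ.sign j
    mᵢ mⱼ : ℕ
    mᵢ = ℤ.∣ i ∣
    mⱼ = ℤ.∣ j ∣
    interchange : ∀ a b u v → (a * b) * (u * v) ≈ (a * u) * (b * v)
    interchange a b u v = begin
      (a * b) * (u * v) ≈⟨ *-assoc a b (u * v) ⟩
      a * (b * (u * v)) ≈⟨ *-congˡ (sym (*-assoc b u v)) ⟩
      a * ((b * u) * v) ≈⟨ *-congˡ (*-congʳ (*-comm b u)) ⟩
      a * ((u * b) * v) ≈⟨ *-congˡ (*-assoc u b v) ⟩
      a * (u * (b * v)) ≈⟨ *-assoc a u (b * v) ⟨
      (a * u) * (b * v) ∎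

  -‿homo : ∀ i → ⟦ ℤ.- i ⟧ℤ ≈ - ⟦ i ⟧ℤ
  -‿homo (pos 0) = sym ε⁻¹≈ε
  -‿homo (pos (suc n)) = refl
  -‿homo -[1+ n ] = sym (⁻¹-involutive _)

  integerMorphism : ℤ.+-*-rawRing -Raw-AlmostCommutative⟶ fromCommutativeRing R
  integerMorphism = record
    { ⟦_⟧ = ⟦_⟧ℤ ; +-homo = +-homo ; *-homo = *-homo ; -‿homo = -‿homo
    ; 0-homo = refl ; 1-homo = +-identityʳ 1# }

  coefficient-equal? : ∀ i j → Maybe (⟦ i ⟧ℤ ≈ ⟦ j ⟧ℤ)
  coefficient-equal? i j with i ℤ.≟ j
  ... | yes ≡.refl = just refl
  ... | no _ = nothing

  open RingSolver ℤ.+-*-rawRing (fromCommutativeRing R) integerMorphism coefficient-equal? public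
    using (solve; _:=_; _:+_; _:*_; :-_; _:-_; con; Polynomial)

module OrderedFieldFacts {ℓ} (F : OrderedField ℓ) where
  open OrderedField F public
  open ≡ using (refl; sym; trans; cong; cong₂; subst; subst₂)

  commutativeRing : CommutativeRing ℓ ℓ
  commutativeRing = record { isCommutativeRing = isCommutativeRing }

  open CommutativeRing commutativeRing public
    using (+-comm; +-identityˡ; +-identityʳ; *-assoc; *-comm; *-identityˡ; *-identityʳ; zeroˡ; zeroʳ; distribʳ)
  open import Algebra.Properties.Ring (CommutativeRing.ring commutativeRing) public
    using (-‿distribʳ-*)
  open import Algebra.Properties.Group (CommutativeRing.+-group commutativeRing) public
    using (ε⁻¹≈ε; ⁻¹-involutive)
  open IntegerCoefficients commutativeRing public
  open IsStrictTotalOrder isStrictTotalOrder public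
    using (compare; _≟_) renaming (trans to <-trans)

  <-irrefl : ∀ {u} → ¬ u < u
  <-irrefl = IsStrictTotalOrder.irrefl isStrictTotalOrder refl

  nonpos-or-pos : ∀ u → u ≤ 0# ⊎ 0# < u
  nonpos-or-pos u with compare u 0#
  ... | tri< u<0 _ _ = inj₁ (inj₁ u<0)
  ... | tri≈ _ u≡0 _ = inj₁ (inj₂ u≡0)
  ... | tri> _ _ u>0 = inj₂ u>0

  nonpos-pos-⊥ : ∀ {u} → u ≤ 0# → 0# < u → ⊥
  nonpos-pos-⊥ (inj₁ u<0) u>0 = <-irrefl (<-trans u<0 u>0)
  nonpos-pos-⊥ (inj₂ refl) u>0 = <-irrefl u>0

  nonneg-nonzero : ∀ {u} → 0# ≤ u → ¬ u ≡ 0# → 0# < u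
  nonneg-nonzero (inj₁ u>0) _ = u>0
  nonneg-nonzero (inj₂ 0≡u) u≢0 = ⊥-elim (u≢0 (sym 0≡u))

  neg-mono-< : ∀ {u v} → u < v → - v < - u
  neg-mono-< {u} {v} u<v = subst₂ _<_ (leaves-v u v) (leaves-u u v) (+-mono-< (- u + - v) u<v)
    where
    leaves-v : ∀ u v → u + (- u + - v) ≡ - v
    leaves-u : ∀ u v → v + (- u + - v) ≡ - u
    leaves-v = solve 2 (λ u v → u :+ (:- u :+ :- v) := :- v) refl
    leaves-u = solve 2 (λ u v → v :+ (:- u :+ :- v) := :- u) refl

  neg-of-neg : ∀ {u} → u < 0# → 0# < - u
  neg-of-neg u<0 = subst (_< _) ε⁻¹≈ε (neg-mono-< u<0)

  neg-of-pos : ∀ {u} → 0# < u → - u < 0#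
  neg-of-pos u>0 = subst (_ <_) ε⁻¹≈ε (neg-mono-< u>0)

  neg-of-nonpos : ∀ {u} → u ≤ 0# → 0# ≤ - u
  neg-of-nonpos (inj₁ u<0) = inj₁ (neg-of-neg u<0)
  neg-of-nonpos (inj₂ refl) = inj₂ (sym ε⁻¹≈ε)

  +-pos-nonneg : ∀ {u v} → 0# < u → 0# ≤ v → 0# < u + v
  +-pos-nonneg {u} u>0 (inj₂ refl) = subst (0# <_) (sym (+-identityʳ u)) u>0
  +-pos-nonneg {u} {v} u>0 (inj₁ v>0) =
    <-trans (subst (0# <_) (sym (+-identityˡ v)) v>0) (+-mono-< v u>0)

  +-nonneg-pos : ∀ {u v} → 0# ≤ u → 0# < v → 0# < u + v
  +-nonneg-pos {u} {v} u≥0 v>0 = subst (0# <_) (+-comm v u) (+-pos-nonneg v>0 u≥0)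

  +-nonneg : ∀ {u v} → 0# ≤ u → 0# ≤ v → 0# ≤ u + v
  +-nonneg (inj₁ u>0) v≥0 = inj₁ (+-pos-nonneg u>0 v≥0)
  +-nonneg {v = v} (inj₂ refl) v≥0 = subst (0# ≤_) (sym (+-identityˡ v)) v≥0

  +-nonpos : ∀ {u v} → u ≤ 0# → v ≤ 0# → u + v ≤ 0#
  +-nonpos {u} {v} (inj₁ u<0) (inj₁ v<0) =
    inj₁ (<-trans (+-mono-< v u<0) (subst (_< 0#) (sym (+-identityˡ v)) v<0))
  +-nonpos {u} (inj₁ u<0) (inj₂ refl) = inj₁ (subst (_< 0#) (sym (+-identityʳ u)) u<0)
  +-nonpos {v = v} (inj₂ refl) v≤0 = subst (_≤ 0#) (sym (+-identityˡ v)) v≤0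

  nonneg-sum-zero : ∀ {u v} → 0# ≤ u → 0# ≤ v → u + v ≡ 0# → u ≡ 0#
  nonneg-sum-zero (inj₁ u>0) v≥0 u+v≡0 = ⊥-elim (<-irrefl (subst (0# <_) u+v≡0 (+-pos-nonneg u>0 v≥0)))
  nonneg-sum-zero (inj₂ refl) _ _ = refl

  *-nonneg : ∀ {u v} → 0# ≤ u → 0# ≤ v → 0# ≤ u * v
  *-nonneg (inj₁ u>0) (inj₁ v>0) = inj₁ (*-pos u>0 v>0)
  *-nonneg {u} (inj₁ _) (inj₂ refl) = inj₂ (sym (zeroʳ u))
  *-nonneg {v = v} (inj₂ refl) _ = inj₂ (sym (zeroˡ v))

  *-pos-neg : ∀ {u v} → 0# < u → v < 0# → u * v < 0#
  *-pos-neg {u} {v} u>0 v<0 =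
    subst (_< 0#) (⁻¹-involutive (u * v))
      (neg-of-pos (subst (0# <_) (sym (-‿distribʳ-* u v)) (*-pos u>0 (neg-of-neg v<0))))

  *-nonneg-nonpos : ∀ {u v} → 0# ≤ u → v ≤ 0# → u * v ≤ 0#
  *-nonneg-nonpos (inj₁ u>0) (inj₁ v<0) = inj₁ (*-pos-neg u>0 v<0)
  *-nonneg-nonpos {u} _ (inj₂ refl) = inj₂ (zeroʳ u)
  *-nonneg-nonpos {v = v} (inj₂ refl) _ = inj₂ (zeroˡ v)

  *-nonpos-pos : ∀ {u v} → u ≤ 0# → 0# < v → u * v ≤ 0#
  *-nonpos-pos {u} {v} u≤0 v>0 = subst (_≤ 0#) (*-comm v u) (*-nonneg-nonpos (inj₁ v>0) u≤0)

  pos-factor-nonpos : ∀ {c u} → 0# < c → c * u ≤ 0# → u ≤ 0#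
  pos-factor-nonpos {u = u} c>0 cu≤0 with nonpos-or-pos u
  ... | inj₁ u≤0 = u≤0
  ... | inj₂ u>0 = ⊥-elim (nonpos-pos-⊥ cu≤0 (*-pos c>0 u>0))

  square-pos : ∀ {u} → ¬ u ≡ 0# → 0# < u * u
  square-pos {u} u≢0 with compare u 0#
  ... | tri< u<0 _ _ = subst (0# <_) (neg-square u) (*-pos (neg-of-neg u<0) (neg-of-neg u<0))
    where
    neg-square : ∀ u → - u * - u ≡ u * u
    neg-square = solve 1 (λ u → :- u :* :- u := u :* u) refl
  ... | tri≈ _ u≡0 _ = ⊥-elim (u≢0 u≡0)
  ... | tri> _ _ u>0 = *-pos u>0 u>0

  square-nonneg : ∀ u → 0# ≤ u * u
  square-nonneg u with compare u 0#
  ... | tri< _ u≢0 _ = inj₁ (square-pos u≢0)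
  ... | tri≈ _ refl _ = inj₂ (sym (zeroˡ 0#))
  ... | tri> _ u≢0 _ = inj₁ (square-pos u≢0)

  0<1 : 0# < 1#
  0<1 = subst (0# <_) (*-identityˡ 1#) (square-pos (λ 1≡0 → 0≢1 (sym 1≡0)))

  inverse-pos : ∀ {u v} → 0# < u → u * v ≡ 1# → 0# < v
  inverse-pos {u} {v} u>0 uv≡1 with compare v 0#
  ... | tri< v<0 _ _ = ⊥-elim (<-irrefl (<-trans (subst (_< 0#) uv≡1 (*-pos-neg u>0 v<0)) 0<1))
  ... | tri≈ _ refl _ = ⊥-elim (0≢1 (trans (sym (zeroʳ u)) uv≡1))
  ... | tri> _ _ v>0 = v>0

  nonneg-summand : ∀ {u v} → 0# ≤ u → u + v ≤ 0# → v ≤ 0#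
  nonneg-summand {u} {v} u≥0 u+v≤0 with nonpos-or-pos v
  ... | inj₁ v≤0 = v≤0
  ... | inj₂ v>0 = ⊥-elim (nonpos-pos-⊥ u+v≤0 (+-nonneg-pos u≥0 v>0))

  pos-combination : ∀ {μ ν p q} → 0# ≤ μ → 0# ≤ ν → 0# < μ + ν →
    0# < p → 0# < q → 0# < μ * p + ν * q
  pos-combination (inj₁ μ>0) ν≥0 _ p>0 q>0 = +-pos-nonneg (*-pos μ>0 p>0) (*-nonneg ν≥0 (inj₁ q>0))
  pos-combination {ν = ν} {p} (inj₂ refl) _ μ+ν>0 _ q>0 =
    +-nonneg-pos (inj₂ (sym (zeroˡ p))) (*-pos (subst (0# <_) (+-identityˡ ν) μ+ν>0) q>0)

  zero-product : ∀ {u v} → u * v ≡ 0# → ¬ v ≡ 0# → u ≡ 0#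
  zero-product {u} {v} uv≡0 v≢0 with inverse v v≢0
  ... | w , vw≡1 = begin
    u             ≡⟨ sym (*-identityʳ u) ⟩
    u * 1#        ≡⟨ cong (u *_) (sym vw≡1) ⟩
    u * (v * w)   ≡⟨ sym (*-assoc u v w) ⟩
    (u * v) * w   ≡⟨ cong (_* w) uv≡0 ⟩
    0# * w        ≡⟨ zeroˡ w ⟩
    0#            ∎
    where open ≡.≡-Reasoning

  second-vanishes-pos : ∀ {μ ν a b} → ν ≡ 0# → 0# < μ + ν → 0# < a → 0# < μ * a + ν * b
  second-vanishes-pos {μ} {a = a} {b} refl μ+0>0 a>0 =
    subst (0# <_) (sym (drop μ a b)) (*-pos (subst (0# <_) (+-identityʳ μ) μ+0>0) a>0)
    where
    drop : ∀ μ a b → μ * a + 0# * b ≡ μ * a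
    drop = solve 3 (λ μ a b → μ :* a :+ con (pos 0) :* b := μ :* a) refl

  -- The exchange inequality: if both "diagonal" forms gᵢ nᵢ + hᵢ pᵢ are
  -- nonpositive (with all pᵢ, nᵢ positive), then so is one of the two
  -- "crossed" forms, because a positive combination of the crossed forms
  -- equals a positive combination of the diagonal ones.
  exchange : ∀ {p₁ p₂ n₁ n₂} g₁ g₂ h₁ h₂ →
    0# < p₁ → 0# < p₂ → 0# < n₁ → 0# < n₂ →
    g₁ * n₁ + h₁ * p₁ ≤ 0# → g₂ * n₂ + h₂ * p₂ ≤ 0# →
    g₁ * n₂ + h₂ * p₁ ≤ 0# ⊎ g₂ * n₁ + h₁ * p₂ ≤ 0#
  exchange {p₁} {p₂} {n₁} {n₂} g₁ g₂ h₁ h₂ p₁>0 p₂>0 n₁>0 n₂>0 d₁ d₂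
    with nonpos-or-pos (g₁ * n₂ + h₂ * p₁) | nonpos-or-pos (g₂ * n₁ + h₁ * p₂)
  ... | inj₁ c₁ | _ = inj₁ c₁
  ... | inj₂ _ | inj₁ c₂ = inj₂ c₂
  ... | inj₂ c₁ | inj₂ c₂ = ⊥-elim (nonpos-pos-⊥ diagonal (subst (0# <_) (swap g₁ g₂ h₁ h₂ p₁ p₂ n₁ n₂) crossed))
    where
    crossed : 0# < (g₁ * n₂ + h₂ * p₁) * (p₂ * n₁) + (g₂ * n₁ + h₁ * p₂) * (p₁ * n₂)
    crossed = +-pos-nonneg (*-pos c₁ (*-pos p₂>0 n₁>0)) (inj₁ (*-pos c₂ (*-pos p₁>0 n₂>0)))
    diagonal : (g₁ * n₁ + h₁ * p₁) * (p₂ * n₂) + (g₂ * n₂ + h₂ * p₂) * (p₁ * n₁) ≤ 0#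
    diagonal = +-nonpos (*-nonpos-pos d₁ (*-pos p₂>0 n₂>0)) (*-nonpos-pos d₂ (*-pos p₁>0 n₁>0))
    swap : ∀ g₁ g₂ h₁ h₂ p₁ p₂ n₁ n₂ →
      (g₁ * n₂ + h₂ * p₁) * (p₂ * n₁) + (g₂ * n₁ + h₁ * p₂) * (p₁ * n₂)
        ≡ (g₁ * n₁ + h₁ * p₁) * (p₂ * n₂) + (g₂ * n₂ + h₂ * p₂) * (p₁ * n₁)
    swap = solve 8 (λ g₁ g₂ h₁ h₂ p₁ p₂ n₁ n₂ →
      (g₁ :* n₂ :+ h₂ :* p₁) :* (p₂ :* n₁) :+ (g₂ :* n₁ :+ h₁ :* p₂) :* (p₁ :* n₂)
        := (g₁ :* n₁ :+ h₁ :* p₁) :* (p₂ :* n₂) :+ (g₂ :* n₂ :+ h₂ :* p₂) :* (p₁ :* n₁)) refl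

module Dependence {ℓ} (F : OrderedField ℓ) where
  open OrderedFieldFacts F
  open ≡ using (refl; sym; trans; cong; cong₂; subst)
  open ≡.≡-Reasoning

  PositivelyDependent : ∀ {n d} → (Fin n → Point F d) → Set ℓ
  PositivelyDependent {n} q = ∃ λ (t : Fin n → Carrier) →
    (∀ i → 0# ≤ t i) × 0# < sumF t × (∀ k → sumF (λ i → t i * q i k) ≡ 0#)

  sumF-cong : ∀ {n} {f g : Fin n → Carrier} → (∀ i → f i ≡ g i) → sumF f ≡ sumF g
  sumF-cong {zero} _ = refl
  sumF-cong {suc n} f≗g = cong₂ _+_ (f≗g zero) (sumF-cong (λ i → f≗g (suc i)))

  sumF-*ʳ : ∀ {n} (f : Fin n → Carrier) u → sumF (λ i → f i * u) ≡ sumF f * u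
  sumF-*ʳ {zero} f u = sym (zeroˡ u)
  sumF-*ʳ {suc n} f u =
    trans (cong ((f zero * u) +_) (sumF-*ʳ (λ i → f (suc i)) u)) (sym (distribʳ u _ _))

  sumF-zero : ∀ {n} → sumF {n} (λ _ → 0#) ≡ 0#
  sumF-zero {zero} = refl
  sumF-zero {suc n} = trans (cong (0# +_) (sumF-zero {n})) (+-identityˡ 0#)

  -- Dividing the weights by their (positive) total turns a positive
  -- dependence into a convex combination.
  hull⇔dependent : ∀ {n d} {q : Fin n → Point F d} → OriginInHull F q ⇔ PositivelyDependent q
  hull⇔dependent {q = q} = mk⇔ to from
    where
    to : OriginInHull F q → PositivelyDependent q
    to (t , t≥0 , Σt≡1 , balanced) = t , t≥0 , subst (0# <_) (sym Σt≡1) 0<1 , balanced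

    reorder : ∀ a b c → a * b * c ≡ a * c * b
    reorder = solve 3 (λ a b c → a :* b :* c := a :* c :* b) refl

    from : PositivelyDependent q → OriginInHull F q
    from (t , t≥0 , Σt>0 , balanced)
      with inverse (sumF t) (λ Σt≡0 → <-irrefl (subst (0# <_) Σt≡0 Σt>0))
    ... | T , ΣtT≡1 =
      (λ i → t i * T) , (λ i → *-nonneg (t≥0 i) (inj₁ T>0)) , trans (sumF-*ʳ t T) ΣtT≡1 , rescaled
      where
      T>0 : 0# < T
      T>0 = inverse-pos Σt>0 ΣtT≡1
      rescaled : ∀ k → sumF (λ i → t i * T * q i k) ≡ 0#
      rescaled k = begin
        sumF (λ i → t i * T * q i k)  ≡⟨ sumF-cong (λ i → reorder (t i) T (q i k)) ⟩
        sumF (λ i → t i * q i k * T)  ≡⟨ sumF-*ʳ (λ i → t i * q i k) T ⟩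
        sumF (λ i → t i * q i k) * T  ≡⟨ cong (_* T) (balanced k) ⟩
        0# * T                        ≡⟨ zeroˡ T ⟩
        0#                            ∎

  origin-vertex : ∀ {n d} (q : Fin (suc n) → Point F d) → (∀ k → q zero k ≡ 0#) → OriginInHull F q
  origin-vertex {n} q q₀≡0 = Equivalence.from (hull⇔dependent {q = q}) (t , t≥0 , Σt>0 , balanced)
    where
    t : Fin (suc n) → Carrier
    t zero = 1#
    t (suc _) = 0#
    t≥0 : ∀ i → 0# ≤ t i
    t≥0 zero = inj₁ 0<1
    t≥0 (suc _) = inj₂ refl
    Σt>0 : 0# < sumF t
    Σt>0 = +-pos-nonneg 0<1 (inj₂ (sym (sumF-zero {n})))
    balanced : ∀ k → sumF (λ i → t i * q i k) ≡ 0#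
    balanced k = begin
      1# * q zero k + sumF (λ i → 0# * q (suc i) k) ≡⟨ cong₂ _+_ (*-identityˡ _) (sumF-cong {n} (λ i → zeroˡ (q (suc i) k))) ⟩
      q zero k + sumF {n} (λ _ → 0#)                ≡⟨ cong₂ _+_ (q₀≡0 k) (sumF-zero {n}) ⟩
      0# + 0#                                       ≡⟨ +-identityˡ 0# ⟩
      0#                                            ∎

-- The plane seen from a fixed point x: every w is measured by its
-- component ⟨x , w⟩ along x and by det(x , w), which says on which side
-- of the line through x it lies.
module Plane {ℓ} (F : OrderedField ℓ) (x : Point F 2) where
  open OrderedFieldFacts F
  open Dependence F
  open ≡ using (refl; sym; trans; cong; cong₂; subst)
  open ≡.≡-Reasoning

  x₀ x₁ : Carrier
  x₀ = x zero
  x₁ = x (suc zero)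

  dot det : Carrier → Carrier → Carrier → Carrier → Carrier
  dot a₀ a₁ b₀ b₁ = a₀ * b₀ + a₁ * b₁
  det a₀ a₁ b₀ b₁ = a₀ * b₁ + - (a₁ * b₀)

  :dot :det : ∀ {m} → Polynomial m → Polynomial m → Polynomial m → Polynomial m → Polynomial m
  :dot a₀ a₁ b₀ b₁ = a₀ :* b₀ :+ a₁ :* b₁
  :det a₀ a₁ b₀ b₁ = a₀ :* b₁ :- a₁ :* b₀

  along side : Point F 2 → Carrier
  along w = dot x₀ x₁ (w zero) (w (suc zero))
  side w = det x₀ x₁ (w zero) (w (suc zero))

  -- w lies on the closed ray from 0 pointing away from x
  Behind : Point F 2 → Set ℓ
  Behind w = side w ≡ 0# × along w ≤ 0#

  -- Certificate that some nonzero nonnegative combination μ y + ν z is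
  -- Behind; for |x| > 0 this is equivalent to 0 ∈ conv(x, y, z).
  record Cone (y z : Point F 2) : Set ℓ where
    field
      μ ν      : Carrier
      μ≥0      : 0# ≤ μ
      ν≥0      : 0# ≤ ν
      μ+ν>0    : 0# < μ + ν
      on-line  : μ * side y + ν * side z ≡ 0#
      behind   : μ * along y + ν * along z ≤ 0#

  -- Taking ⟨x , ·⟩ and det(x , ·) of a dependence t₀ x + t₁ y + t₂ z = 0
  -- gives t₀ |x|² + t₁ ⟨x,y⟩ + t₂ ⟨x,z⟩ = 0 and t₁ det(x,y) + t₂ det(x,z) = 0,
  -- so (t₁ , t₂) is a Cone certificate.
  dependent→cone : 0# < along x → ∀ {y z} → PositivelyDependent (x ∷ y ∷ z ∷ []) → Cone y z
  dependent→cone |x|>0 {y} {z} (t , t≥0 , Σt>0 , balanced) = record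
    { μ = t₁ ; ν = t₂ ; μ≥0 = t≥0 _ ; ν≥0 = t≥0 _
    ; μ+ν>0 = nonneg-nonzero (+-nonneg (t≥0 _) (t≥0 _)) degenerate
    ; on-line = on-line
    ; behind = nonneg-summand (*-nonneg (t≥0 _) (inj₁ |x|>0)) (inj₂ along-balance) }
    where
    t₀ t₁ t₂ : Carrier
    t₀ = t zero
    t₁ = t (suc zero)
    t₂ = t (suc (suc zero))

    weighted : Fin 2 → Carrier
    weighted k = t₀ * x k + (t₁ * y k + (t₂ * z k + 0#))

    side-identity : ∀ t₀ t₁ t₂ x₀ x₁ y₀ y₁ z₀ z₁ →
      t₁ * det x₀ x₁ y₀ y₁ + t₂ * det x₀ x₁ z₀ z₁
        ≡ x₀ * (t₀ * x₁ + (t₁ * y₁ + (t₂ * z₁ + 0#))) + - (x₁ * (t₀ * x₀ + (t₁ * y₀ + (t₂ * z₀ + 0#))))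
    side-identity = solve 9 (λ t₀ t₁ t₂ x₀ x₁ y₀ y₁ z₀ z₁ →
      t₁ :* :det x₀ x₁ y₀ y₁ :+ t₂ :* :det x₀ x₁ z₀ z₁
        := x₀ :* (t₀ :* x₁ :+ (t₁ :* y₁ :+ (t₂ :* z₁ :+ con (pos 0))))
           :- x₁ :* (t₀ :* x₀ :+ (t₁ :* y₀ :+ (t₂ :* z₀ :+ con (pos 0))))) refl

    along-identity : ∀ t₀ t₁ t₂ x₀ x₁ y₀ y₁ z₀ z₁ →
      t₀ * dot x₀ x₁ x₀ x₁ + (t₁ * dot x₀ x₁ y₀ y₁ + t₂ * dot x₀ x₁ z₀ z₁)
        ≡ x₀ * (t₀ * x₀ + (t₁ * y₀ + (t₂ * z₀ + 0#))) + x₁ * (t₀ * x₁ + (t₁ * y₁ + (t₂ * z₁ + 0#)))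
    along-identity = solve 9 (λ t₀ t₁ t₂ x₀ x₁ y₀ y₁ z₀ z₁ →
      t₀ :* :dot x₀ x₁ x₀ x₁ :+ (t₁ :* :dot x₀ x₁ y₀ y₁ :+ t₂ :* :dot x₀ x₁ z₀ z₁)
        := x₀ :* (t₀ :* x₀ :+ (t₁ :* y₀ :+ (t₂ :* z₀ :+ con (pos 0))))
           :+ x₁ :* (t₀ :* x₁ :+ (t₁ :* y₁ :+ (t₂ :* z₁ :+ con (pos 0))))) refl

    on-line : t₁ * side y + t₂ * side z ≡ 0#
    on-line = begin
      t₁ * side y + t₂ * side z
        ≡⟨ side-identity t₀ t₁ t₂ x₀ x₁ (y zero) (y (suc zero)) (z zero) (z (suc zero)) ⟩
      x₀ * weighted (suc zero) + - (x₁ * weighted zero)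
        ≡⟨ cong₂ (λ u v → x₀ * u + - (x₁ * v)) (balanced (suc zero)) (balanced zero) ⟩
      x₀ * 0# + - (x₁ * 0#)
        ≡⟨ cong₂ _+_ (zeroʳ x₀) (trans (cong -_ (zeroʳ x₁)) ε⁻¹≈ε) ⟩
      0# + 0#
        ≡⟨ +-identityˡ 0# ⟩
      0# ∎

    along-balance : t₀ * along x + (t₁ * along y + t₂ * along z) ≡ 0#
    along-balance = begin
      t₀ * along x + (t₁ * along y + t₂ * along z)
        ≡⟨ along-identity t₀ t₁ t₂ x₀ x₁ (y zero) (y (suc zero)) (z zero) (z (suc zero)) ⟩
      x₀ * weighted zero + x₁ * weighted (suc zero)
        ≡⟨ cong₂ (λ u v → x₀ * u + x₁ * v) (balanced zero) (balanced (suc zero)) ⟩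
      x₀ * 0# + x₁ * 0#
        ≡⟨ cong₂ _+_ (zeroʳ x₀) (zeroʳ x₁) ⟩
      0# + 0#
        ≡⟨ +-identityˡ 0# ⟩
      0# ∎

    -- if t₁ = t₂ = 0 the balance along x forces t₀ |x|² = 0, so all weights vanish
    only-first : ∀ {a b c} → b ≡ 0# → c ≡ 0# →
      a * along x + (b * along y + c * along z) ≡ 0# → ¬ 0# < a + (b + (c + 0#))
    only-first {a} refl refl balance Σ>0 = <-irrefl (subst (0# <_) (trans (pad a) a≡0) Σ>0)
      where
      pad : ∀ a → a + (0# + (0# + 0#)) ≡ a
      pad = solve 1 (λ a → a :+ (con (pos 0) :+ (con (pos 0) :+ con (pos 0))) := a) refl
      drop : ∀ a N u v → a * N + (0# * u + 0# * v) ≡ a * N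
      drop = solve 4 (λ a N u v → a :* N :+ (con (pos 0) :* u :+ con (pos 0) :* v) := a :* N) refl
      a≡0 : a ≡ 0#
      a≡0 = zero-product (trans (sym (drop a (along x) (along y) (along z))) balance)
                         (λ |x|≡0 → <-irrefl (subst (0# <_) |x|≡0 |x|>0))

    degenerate : ¬ t₁ + t₂ ≡ 0#
    degenerate t₁+t₂≡0 = only-first
      (nonneg-sum-zero (t≥0 _) (t≥0 _) t₁+t₂≡0)
      (nonneg-sum-zero (t≥0 _) (t≥0 _) (trans (+-comm t₂ t₁) t₁+t₂≡0))
      along-balance Σt>0

  -- Conversely, (−(μ⟨x,y⟩ + ν⟨x,z⟩) , |x|² μ , |x|² ν) weights x, y, z to 0,
  -- because |x|² w = ⟨x,w⟩ x + det(x,w) x⊥.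
  cone→dependent : 0# < along x → ∀ {y z} → Cone y z → PositivelyDependent (x ∷ y ∷ z ∷ [])
  cone→dependent |x|>0 {y} {z} C = t , t≥0 , Σt>0 , balanced
    where
    open Cone C
    N : Carrier
    N = along x
    t : Fin 3 → Carrier
    t = - (μ * along y + ν * along z) ∷ N * μ ∷ N * ν ∷ []

    t≥0 : ∀ i → 0# ≤ t i
    t≥0 zero = neg-of-nonpos behind
    t≥0 (suc zero) = *-nonneg (inj₁ |x|>0) μ≥0
    t≥0 (suc (suc zero)) = *-nonneg (inj₁ |x|>0) ν≥0

    total : ∀ a N μ ν → a + (N * μ + (N * ν + 0#)) ≡ a + N * (μ + ν)
    total = solve 4 (λ a N μ ν → a :+ (N :* μ :+ (N :* ν :+ con (pos 0))) := a :+ N :* (μ :+ ν)) refl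

    Σt>0 : 0# < sumF t
    Σt>0 = subst (0# <_) (sym (total _ N μ ν)) (+-nonneg-pos (t≥0 zero) (*-pos |x|>0 μ+ν>0))

    first-coordinate : ∀ μ ν x₀ x₁ y₀ y₁ z₀ z₁ →
      - (μ * dot x₀ x₁ y₀ y₁ + ν * dot x₀ x₁ z₀ z₁) * x₀
        + (dot x₀ x₁ x₀ x₁ * μ * y₀ + (dot x₀ x₁ x₀ x₁ * ν * z₀ + 0#))
      ≡ - (x₁ * (μ * det x₀ x₁ y₀ y₁ + ν * det x₀ x₁ z₀ z₁))
    first-coordinate = solve 8 (λ μ ν x₀ x₁ y₀ y₁ z₀ z₁ →
      :- (μ :* :dot x₀ x₁ y₀ y₁ :+ ν :* :dot x₀ x₁ z₀ z₁) :* x₀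
        :+ (:dot x₀ x₁ x₀ x₁ :* μ :* y₀ :+ (:dot x₀ x₁ x₀ x₁ :* ν :* z₀ :+ con (pos 0)))
      := :- (x₁ :* (μ :* :det x₀ x₁ y₀ y₁ :+ ν :* :det x₀ x₁ z₀ z₁))) refl

    second-coordinate : ∀ μ ν x₀ x₁ y₀ y₁ z₀ z₁ →
      - (μ * dot x₀ x₁ y₀ y₁ + ν * dot x₀ x₁ z₀ z₁) * x₁
        + (dot x₀ x₁ x₀ x₁ * μ * y₁ + (dot x₀ x₁ x₀ x₁ * ν * z₁ + 0#))
      ≡ x₀ * (μ * det x₀ x₁ y₀ y₁ + ν * det x₀ x₁ z₀ z₁)
    second-coordinate = solve 8 (λ μ ν x₀ x₁ y₀ y₁ z₀ z₁ →
      :- (μ :* :dot x₀ x₁ y₀ y₁ :+ ν :* :dot x₀ x₁ z₀ z₁) :* x₁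
        :+ (:dot x₀ x₁ x₀ x₁ :* μ :* y₁ :+ (:dot x₀ x₁ x₀ x₁ :* ν :* z₁ :+ con (pos 0)))
      := x₀ :* (μ :* :det x₀ x₁ y₀ y₁ :+ ν :* :det x₀ x₁ z₀ z₁)) refl

    balanced : ∀ k → sumF (λ i → t i * (x ∷ y ∷ z ∷ []) i k) ≡ 0#
    balanced zero = begin
      sumF (λ i → t i * (x ∷ y ∷ z ∷ []) i zero) ≡⟨ first-coordinate μ ν x₀ x₁ (y zero) (y (suc zero)) (z zero) (z (suc zero)) ⟩
      - (x₁ * (μ * side y + ν * side z)) ≡⟨ cong (λ u → - (x₁ * u)) on-line ⟩
      - (x₁ * 0#)                        ≡⟨ trans (cong -_ (zeroʳ x₁)) ε⁻¹≈ε ⟩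
      0#                                 ∎
    balanced (suc zero) = begin
      sumF (λ i → t i * (x ∷ y ∷ z ∷ []) i (suc zero)) ≡⟨ second-coordinate μ ν x₀ x₁ (y zero) (y (suc zero)) (z zero) (z (suc zero)) ⟩
      x₀ * (μ * side y + ν * side z)     ≡⟨ cong (x₀ *_) on-line ⟩
      x₀ * 0#                            ≡⟨ zeroʳ x₀ ⟩
      0#                                 ∎

  hull⇔cone : 0# < along x → ∀ {y z} → OriginInHull F (x ∷ y ∷ z ∷ []) ⇔ Cone y z
  hull⇔cone |x|>0 {y} {z} =
    mk⇔ (dependent→cone |x|>0) (cone→dependent |x|>0) ⇔-∘ hull⇔dependent {q = x ∷ y ∷ z ∷ []}

  cone-swap : ∀ {y z} → Cone y z → Cone z y
  cone-swap C = record
    { μ = ν ; ν = μ ; μ≥0 = ν≥0 ; ν≥0 = μ≥0 ; μ+ν>0 = subst (0# <_) (+-comm μ ν) μ+ν>0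
    ; on-line = trans (+-comm _ _) on-line ; behind = subst (_≤ 0#) (+-comm _ _) behind }
    where open Cone C

  behind-cone : ∀ {y} → Behind y → ∀ z → Cone y z
  behind-cone {y} (side≡0 , along≤0) z = record
    { μ = 1# ; ν = 0# ; μ≥0 = inj₁ 0<1 ; ν≥0 = inj₂ refl
    ; μ+ν>0 = subst (0# <_) (sym (+-identityʳ 1#)) 0<1
    ; on-line = trans (first-only (side y) (side z)) side≡0
    ; behind = subst (_≤ 0#) (sym (first-only (along y) (along z))) along≤0 }
    where
    first-only : ∀ u v → 1# * u + 0# * v ≡ u
    first-only u v = trans (cong₂ _+_ (*-identityˡ u) (zeroˡ v)) (+-identityʳ u)

  positive-side-⊥ : ∀ {y z} → Cone y z → 0# < side y → 0# < side z → ⊥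
  positive-side-⊥ C sy>0 sz>0 = <-irrefl (subst (0# <_) on-line (pos-combination μ≥0 ν≥0 μ+ν>0 sy>0 sz>0))
    where open Cone C

  negative-side-⊥ : ∀ {y z} → Cone y z → side y < 0# → side z < 0# → ⊥
  negative-side-⊥ {y} {z} C sy<0 sz<0 =
    <-irrefl (subst (0# <_) negated (pos-combination μ≥0 ν≥0 μ+ν>0 (neg-of-neg sy<0) (neg-of-neg sz<0)))
    where
    open Cone C
    flip : ∀ μ ν u v → μ * - u + ν * - v ≡ - (μ * u + ν * v)
    flip = solve 4 (λ μ ν u v → μ :* :- u :+ ν :* :- v := :- (μ :* u :+ ν :* v)) refl
    negated : μ * - side y + ν * - side z ≡ 0#
    negated = trans (flip μ ν (side y) (side z)) (trans (cong -_ on-line) ε⁻¹≈ε)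

  -- If y lies on the line through x but in front of 0, a certificate can
  -- only use z, which must then be Behind.
  on-line-behind : ∀ {y z} → Cone y z → side y ≡ 0# → Behind y ⊎ Behind z
  on-line-behind {y} {z} C sy≡0 with nonpos-or-pos (along y)
  ... | inj₁ ay≤0 = inj₁ (sy≡0 , ay≤0)
  ... | inj₂ ay>0 = inj₂ (sz≡0 , az≤0)
    where
    open Cone C
    νsz≡0 : ν * side z ≡ 0#
    νsz≡0 = begin
      ν * side z               ≡⟨ sym (+-identityˡ _) ⟩
      0# + ν * side z          ≡⟨ cong (_+ ν * side z) (sym (trans (cong (μ *_) sy≡0) (zeroʳ μ))) ⟩
      μ * side y + ν * side z  ≡⟨ on-line ⟩
      0#                       ∎
    sz≡0 : side z ≡ 0#
    sz≡0 with side z ≟ 0#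
    ... | yes sz≡0 = sz≡0
    ... | no sz≢0 = ⊥-elim (nonpos-pos-⊥ behind (second-vanishes-pos (zero-product νsz≡0 sz≢0) μ+ν>0 ay>0))
    az≤0 : along z ≤ 0#
    az≤0 with nonpos-or-pos (along z)
    ... | inj₁ az≤0 = az≤0
    ... | inj₂ az>0 = ⊥-elim (nonpos-pos-⊥ behind (pos-combination μ≥0 ν≥0 μ+ν>0 ay>0 az>0))

  Straddles Straddles⁻ : Point F 2 → Point F 2 → Set ℓ
  Straddles y z = 0# < side y × side z < 0#
  Straddles⁻ y z = side y < 0# × 0# < side z

  straddle : ∀ {y z} → Cone y z → ¬ Behind y → ¬ Behind z → Straddles y z ⊎ Straddles⁻ y z
  straddle {y} {z} C ¬by ¬bz with compare (side y) 0# | compare (side z) 0#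
  ... | tri≈ _ sy≡0 _ | _ = ⊥-elim ([ ¬by , ¬bz ] (on-line-behind C sy≡0))
  ... | _ | tri≈ _ sz≡0 _ = ⊥-elim ([ ¬bz , ¬by ] (on-line-behind (cone-swap C) sz≡0))
  ... | tri< sy<0 _ _ | tri< sz<0 _ _ = ⊥-elim (negative-side-⊥ C sy<0 sz<0)
  ... | tri> _ _ sy>0 | tri> _ _ sz>0 = ⊥-elim (positive-side-⊥ C sy>0 sz>0)
  ... | tri> _ _ sy>0 | tri< sz<0 _ _ = inj₁ (sy>0 , sz<0)
  ... | tri< sy<0 _ _ | tri> _ _ sz>0 = inj₂ (sy<0 , sz>0)

  -- For a straddling pair, containment is the sign of a bilinear form: the
  -- certificate is unique up to scaling, namely (μ , ν) = (−det(x,z) , det(x,y)).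
  crossing : Point F 2 → Point F 2 → Carrier
  crossing y z = along y * - side z + along z * side y

  cone⇔crossing : ∀ {y z} → Straddles y z → Cone y z ⇔ crossing y z ≤ 0#
  cone⇔crossing {y} {z} (sy>0 , sz<0) = mk⇔ to from
    where
    to : Cone y z → crossing y z ≤ 0#
    to C = pos-factor-nonpos μ>0 (subst (_≤ 0#) (sym scaled) (*-nonneg-nonpos (inj₁ (neg-of-neg sz<0)) behind))
      where
      open Cone C
      -- a certificate cannot live on z alone, since det(x , z) ≠ 0
      not-z-only : ∀ {a b} → a ≡ 0# → 0# < a + b → ¬ a * side y + b * side z ≡ 0#
      not-z-only {b = b} refl a+b>0 e = <-irrefl (subst (_< 0#) bsz≡0 (*-pos-neg b>0 sz<0))
        where
        b>0 : 0# < b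
        b>0 = subst (0# <_) (+-identityˡ b) a+b>0
        bsz≡0 : b * side z ≡ 0#
        bsz≡0 = trans (sym (trans (cong (_+ b * side z) (zeroˡ (side y))) (+-identityˡ _))) e
      μ>0 : 0# < μ
      μ>0 = nonneg-nonzero μ≥0 (λ μ≡0 → not-z-only μ≡0 μ+ν>0 on-line)
      rearrange : ∀ μ ν a b s r → μ * (a * - r + b * s) ≡ - r * (μ * a + ν * b) + b * (μ * s + ν * r)
      rearrange = solve 6 (λ μ ν a b s r →
        μ :* (a :* :- r :+ b :* s) := :- r :* (μ :* a :+ ν :* b) :+ b :* (μ :* s :+ ν :* r)) refl
      scaled : μ * crossing y z ≡ - side z * (μ * along y + ν * along z)
      scaled = begin
        μ * crossing y z ≡⟨ rearrange μ ν (along y) (along z) (side y) (side z) ⟩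
        - side z * (μ * along y + ν * along z) + along z * (μ * side y + ν * side z)
          ≡⟨ cong (λ u → - side z * (μ * along y + ν * along z) + along z * u) on-line ⟩
        - side z * (μ * along y + ν * along z) + along z * 0#
          ≡⟨ trans (cong (- side z * (μ * along y + ν * along z) +_) (zeroʳ (along z))) (+-identityʳ _) ⟩
        - side z * (μ * along y + ν * along z) ∎

    from : crossing y z ≤ 0# → Cone y z
    from crossing≤0 = record
      { μ = - side z ; ν = side y ; μ≥0 = inj₁ (neg-of-neg sz<0) ; ν≥0 = inj₁ sy>0
      ; μ+ν>0 = +-pos-nonneg (neg-of-neg sz<0) (inj₁ sy>0)
      ; on-line = cancel (side y) (side z)
      ; behind = subst (_≤ 0#) (cong₂ _+_ (*-comm _ _) (*-comm _ _)) crossing≤0 }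
      where
      cancel : ∀ s r → - r * s + s * r ≡ 0#
      cancel = solve 2 (λ s r → :- r :* s :+ s :* r := con (pos 0)) refl

  crossed-pair : ∀ {y₁ z₁ y₂ z₂} → Straddles y₁ z₁ → Straddles y₂ z₂ →
    Cone y₁ z₁ → Cone y₂ z₂ → Cone y₁ z₂ ⊎ Cone y₂ z₁
  crossed-pair {y₁} {z₁} {y₂} {z₂} s₁@(sy₁>0 , sz₁<0) s₂@(sy₂>0 , sz₂<0) C₁ C₂ =
    ⊎-map (Equivalence.from (cone⇔crossing (sy₁>0 , sz₂<0)))
                 (Equivalence.from (cone⇔crossing (sy₂>0 , sz₁<0)))
      (exchange (along y₁) (along y₂) (along z₁) (along z₂)
                sy₁>0 sy₂>0 (neg-of-neg sz₁<0) (neg-of-neg sz₂<0)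
                (Equivalence.to (cone⇔crossing s₁) C₁) (Equivalence.to (cone⇔crossing s₂) C₂))

  no-perfect-matching : 0# < along x → (y z : Fin 3 → Point F 2) →
    (∀ i j → Cone (y i) (z j) ⇔ i ≡ j) → ⊥
  no-perfect-matching |x|>0 y z contains =
    two-alike (pigeonhole (s≤s (s≤s (s≤s z≤n))) (λ i → code (orientation i)))
    where
    diagonal : ∀ i → Cone (y i) (z i)
    diagonal i = Equivalence.from (contains i i) refl

    off-diagonal : ∀ {i j} → i ≢ j → ¬ Cone (y i) (z j)
    off-diagonal i≢j C = i≢j (Equivalence.to (contains _ _) C)

    other : Fin 3 → Fin 3
    other zero = suc zero
    other (suc _) = zero

    other≢ : ∀ i → i ≢ other i
    other≢ zero ()
    other≢ (suc _) ()

    orientation : ∀ i → Straddles (y i) (z i) ⊎ Straddles⁻ (y i) (z i)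
    orientation i = straddle (diagonal i)
      (λ b → off-diagonal (other≢ i) (behind-cone b (z (other i))))
      (λ b → off-diagonal (other≢ i ∘ sym) (cone-swap (behind-cone b (y (other i)))))

    code : ∀ {i} → Straddles (y i) (z i) ⊎ Straddles⁻ (y i) (z i) → Fin 2
    code (inj₁ _) = zero
    code (inj₂ _) = suc zero

    clash : ∀ {i j} → i ≢ j → (oᵢ : Straddles (y i) (z i) ⊎ Straddles⁻ (y i) (z i))
      (oⱼ : Straddles (y j) (z j) ⊎ Straddles⁻ (y j) (z j)) → code oᵢ ≡ code oⱼ → ⊥
    clash i≢j (inj₁ sᵢ) (inj₁ sⱼ) _ =
      [ off-diagonal i≢j , off-diagonal (i≢j ∘ sym) ] (crossed-pair sᵢ sⱼ (diagonal _) (diagonal _))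
    clash i≢j (inj₂ (syᵢ<0 , szᵢ>0)) (inj₂ (syⱼ<0 , szⱼ>0)) _ =
      [ off-diagonal (i≢j ∘ sym) ∘ cone-swap , off-diagonal i≢j ∘ cone-swap ]
        (crossed-pair (szᵢ>0 , syᵢ<0) (szⱼ>0 , syⱼ<0) (cone-swap (diagonal _)) (cone-swap (diagonal _)))
    clash _ (inj₁ _) (inj₂ _) ()
    clash _ (inj₂ _) (inj₁ _) ()

    two-alike : (∃₂ λ i j → i Fin.< j × code (orientation i) ≡ code (orientation j)) → ⊥
    two-alike (i , j , i<j , same) = clash (<⇒≢ i<j) (orientation i) (orientation j) same

  origin-or-positive : (∀ k → x k ≡ 0#) ⊎ 0# < along x
  origin-or-positive with x₀ ≟ 0# | x₁ ≟ 0#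
  ... | no x₀≢0 | _ = inj₂ (+-pos-nonneg (square-pos x₀≢0) (square-nonneg x₁))
  ... | yes _ | no x₁≢0 = inj₂ (+-nonneg-pos (square-nonneg x₀) (square-pos x₁≢0))
  ... | yes x₀≡0 | yes x₁≡0 = inj₁ λ { zero → x₀≡0 ; (suc zero) → x₁≡0 }

-- A hypergraph ignoring the first colour class is octahedral: inside any X
-- its edges come in pairs differing only in the first-colour vertex.
cylinder : ∀ {n m} → Hypergraph n m → Hypergraph (suc n) m
cylinder H f = H (λ i → f (suc i))

cylinder-octahedral : ∀ {n m} → m ≥ 2 → (H : Hypergraph n m) → IsOctahedral (cylinder H)
cylinder-octahedral m≥2 H = m≥2 , λ a b _ → double-even (edgesIn H (a ∘ suc) (b ∘ suc))
  where
  double-even : ∀ K → 2 ∣ K ℕ.+ K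
  double-even K = divides K (≡.sym (≡.trans (ℕ.*-comm K 2) (≡.cong (K ℕ.+_) (ℕ.+-identityʳ K))))

diagonal : Hypergraph 2 3
diagonal g = ⌊ g zero Fin.≟ g (suc zero) ⌋

matching : Hypergraph 3 3
matching = cylinder diagonal

matching-edge : ∀ (i j : Fin 3) → matching (zero ∷ i ∷ j ∷ []) ≡ true ⇔ i ≡ j
matching-edge i j with i Fin.≟ j
... | yes i≡j = mk⇔ (λ _ → i≡j) (λ _ → ≡.refl)
... | no i≢j = mk⇔ (λ ()) (⊥-elim ∘ i≢j)

not-realisable : ∀ {ℓ} (F : OrderedField ℓ) → ¬ RealisableOver F 2 matching
not-realisable F (P , _ , edge⇔hull) =
  [ (λ x≡0 → zero≢one (Equivalence.to (hull⇔diagonal zero (suc zero))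
                                       (origin-vertex (x ∷ y zero ∷ z (suc zero) ∷ []) x≡0)))
  , (λ |x|>0 → no-perfect-matching |x|>0 y z
                 (λ i j → hull⇔diagonal i j ⇔-∘ ⇔-sym (hull⇔cone |x|>0))) ]
  origin-or-positive
  where
  x : Point F 2
  x = P zero zero
  y z : Fin 3 → Point F 2
  y = P (suc zero)
  z = P (suc (suc zero))
  open Plane F x
  open Dependence F using (origin-vertex)

  zero≢one : zero ≢ suc zero
  zero≢one ()

  hull⇔diagonal : ∀ i j → OriginInHull F (x ∷ y i ∷ z j ∷ []) ⇔ i ≡ j
  hull⇔diagonal i j = matching-edge i j ⇔-∘ ⇔-sym (edge⇔hull (zero ∷ i ∷ j ∷ []))

proposition3p3 : ∃ λ (d : ℕ) → d ≥ 1 × ∃ λ (E : Hypergraph (suc d) (suc d)) →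
    IsOctahedral E × (∀ (F : OrderedField 0ℓ) → ¬ RealisableOver F d E)
proposition3p3 = 2 , s≤s z≤n , matching , cylinder-octahedral (s≤s (s≤s z≤n)) diagonal , not-realisable
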